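{- For every $d\ge1$, the group $\mathbb{Z}^d$ has the finite filling property: for every non-linear finite set $S\Subset\mathbb{Z}^d$, the $S$-filling closure of every finite subset of $\mathbb{Z}^d$ is finite. In particular, $\mathbb{Z}^d$ has the finite solitaire property: for every non-linear $S\Subset\mathbb{Z}^d$, the $S$-solitaire orbit of every finite subset is finite.
   Context: A finite set $S\subset\mathbb{Z}^d$ is linear if there exist $\vec a,\vec b\in\mathbb{Z}^d$ with $\vec b\neq0$ such that $S\subset\vec a+\mathbb{Z}\vec b$. An $S$-filling move takes $P\subset\mathbb{Z}^d$ to $P\cup(\vec v+S)$ whenever $|P\cap(\vec v+S)|=|S|-1$ for some $\vec v$; this process is confluent, and the $S$-filling closure $\varphi_S(P)$ is the union of all sets reachable from $P$ by finitely many filling moves. An $S$-solitaire move is a pair $(P,Q)$ with $|P\cap(\vec v+S)|=|Q\cap(\vec v+S)|=|S|-1$ and $P\triangle Q$ a $2$-element subset of $\vec v+S$ for some $\vec v\in\mathbb{Z}^d$; the $S$-solitaire orbit of $P$ is its equivalence class under the reflexive-transitive closure of moves. -}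

module Defs where

open import Data.Nat using (ℕ; suc; _≤_)
open import Data.Integer as ℤ using (ℤ)
open import Data.Vec using (Vec; zipWith; replicate)
import Data.Vec.Properties as VecP
open import Data.List using (List; map; filter; length; _++_)
open import Data.List.Relation.Unary.Unique.Propositional using (Unique)
open import Data.Product using (Σ; ∃; ∃-syntax; _×_; _,_)
open import Data.Sum using (_⊎_)
open import Relation.Nullary using (¬_)
open import Relation.Binary.PropositionalEquality using (_≡_; _≢_)
open import Relation.Binary.Construct.Closure.ReflexiveTransitive using (Star)
open import Relation.Binary.Definitions using (DecidableEquality)
open import Function.Bundles using (_⇔_)

Point : ℕ → Set
Point d = Vec ℤ d

_≟ₚ_ : ∀ {d} → DecidableEquality (Point d)
_≟ₚ_ = VecP.≡-dec ℤ._≟_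

module _ {d : ℕ} where
  open import Data.List.Membership.DecPropositional (_≟ₚ_ {d}) public
    using (_∈_; _∉_; _∈?_)

_⊕_ : ∀ {d} → Point d → Point d → Point d
_⊕_ = zipWith ℤ._+_

_⊙_ : ∀ {d} → ℤ → Point d → Point d
k ⊙ b = Data.Vec.map (k ℤ.*_) b

𝟎 : ∀ {d} → Point d
𝟎 = replicate _ (ℤ.+ 0)

-- A finite set S ⊂ ℤ^d is given as a duplicate-free list.
-- Finite sets P ⊂ ℤ^d (starting configurations) are given as lists
-- (duplicates harmless; a set is its membership predicate).

_+ˢ_ : ∀ {d} → Point d → List (Point d) → List (Point d)
v +ˢ S = map (v ⊕_) S

-- |P ∩ T| for T duplicate-free: number of elements of T lying in P
∣_∩_∣ : ∀ {d} → List (Point d) → List (Point d) → ℕ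
∣ P ∩ T ∣ = length (filter (_∈? P) T)

Linear : ∀ {d} → List (Point d) → Set
Linear {d} S = ∃[ a ] ∃[ b ] (b ≢ 𝟎 × (∀ s → s ∈ S → ∃[ k ] s ≡ a ⊕ (k ⊙ b)))

FillMove : ∀ {d} → List (Point d) → List (Point d) → List (Point d) → Set
FillMove S P Q = ∃[ v ] (suc ∣ P ∩ (v +ˢ S) ∣ ≡ length S × Q ≡ P ++ (v +ˢ S))

_∈φ[_]_ : ∀ {d} → Point d → List (Point d) → List (Point d) → Set
x ∈φ[ S ] P = ∃[ Q ] (Star (FillMove S) P Q × x ∈ Q)

FiniteClosure : ∀ {d} → List (Point d) → List (Point d) → Set
FiniteClosure {d} S P = ∃[ L ] (∀ (x : Point d) → x ∈φ[ S ] P → x ∈ L)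

SolMove : ∀ {d} → List (Point d) → List (Point d) → List (Point d) → Set
SolMove {d} S P Q =
  ∃[ v ] ∃[ x ] ∃[ y ]
    ( x ≢ y × x ∈ (v +ˢ S) × y ∈ (v +ˢ S)
    × suc ∣ P ∩ (v +ˢ S) ∣ ≡ length S
    × suc ∣ Q ∩ (v +ˢ S) ∣ ≡ length S
    × (∀ (z : Point d) → ((z ∈ P × z ∉ Q) ⊎ (z ∉ P × z ∈ Q)) ⇔ (z ≡ x ⊎ z ≡ y)))

-- The solitaire orbit of P is finite: finitely many sets (up to equality
-- of sets, i.e. extensional membership) are reachable from P.
-- (Every set in the orbit of a finite P is finite, since moves change
-- only two points, so representing them as lists loses nothing.)
FiniteOrbit : ∀ {d} → List (Point d) → List (Point d) → Set
FiniteOrbit {d} S P =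
  ∃[ Ls ] (∀ Q → Star (SolMove S) P Q →
            ∃[ L ] (L ∈ₗ Ls × (∀ (z : Point d) → (z ∈ Q) ⇔ (z ∈ L))))
  where
  open import Data.List.Membership.Propositional using () renaming (_∈_ to _∈ₗ_)

-- Call a functional c good for S (MaximisedTwice S c) if its maximum over S is attained at two
-- distinct points. A translate v + S that P fills up to one point then contains a point of P at
-- which c is maximal on v + S, so every bound c · x ≤ M on P survives filling and solitaire
-- moves. If S is not linear, every functional c is a positive multiple of a nonnegative
-- combination of two good ones: at a maximiser s₀ of c some direction u has points of S
-- strictly on both sides of s₀ (a nonzero 2×2 minor of differences; if all vanish, S lies on a
-- line), and tilting c towards u and towards −u until a second maximiser appears yields the two
-- good functionals. Applied to ±eⱼ this bounds every coordinate, so everything reachable from P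
-- lies in a fixed finite box.

module Submission where

open import Defs

open import Data.Bool using (true; false)
open import Data.Empty using (⊥-elim)
open import Data.Fin using (Fin; zero; suc)
open import Data.Integer as ℤ using (ℤ; +_; -[1+_]; +[1+_]; _+_; _*_; -_; _-_; 0ℤ; 1ℤ; _≤_; _<_)
import Data.Integer.Properties as ℤP
open import Data.Integer.Tactic.RingSolver using (solve-∀)
open import Data.List as L using (List; []; _∷_; map; filter; length; _++_)
import Data.List.Membership.Propositional as Mem
import Data.List.Membership.Propositional.Properties as MemP
import Data.List.Properties as LP
import Data.List.Relation.Unary.All as All
open import Data.List.Relation.Unary.Any as Any using (here; there)
open import Data.List.Relation.Unary.Unique.Propositional using (Unique)
open import Data.Nat as ℕ using (ℕ; zero; suc; s≤s)
open import Data.Nat.Divisibility using (_∣_)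
open import Data.Nat.GCD using (gcd; gcd[m,n]∣m; gcd[m,n]∣n; gcd-GCD; module Bézout)
import Data.Nat.Properties as ℕP
open import Data.Product using (∃-syntax; _×_; _,_; proj₁; proj₂)
open import Data.Rational.Unnormalised using (ℚᵘ; mkℚᵘ; *≤*)
import Data.Rational.Unnormalised.Properties as ℚᵘP
open import Data.Sum as Sum using (_⊎_; inj₁; inj₂)
open import Data.Vec as V using ([]; _∷_; lookup)
import Data.Vec.Properties as VP
open import Function using (_∘_; id)
open import Function.Bundles using (Equivalence)
import Level
open import Relation.Binary.Construct.Closure.ReflexiveTransitive as Star using (Star)
open import Relation.Binary.Definitions using (tri<; tri≈; tri>)
open import Relation.Binary.PropositionalEquality
open import Relation.Nullary using (¬_; yes; no; does)
open import Relation.Nullary.Decidable using (toSum)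
open import Relation.Unary using (Pred; Decidable)

open import Algebra.Properties.AbelianGroup ℤP.+-0-abelianGroup using () renaming (∙-cancelˡ to +-cancelˡ)
open import Data.List.Extrema ℚᵘP.≤-totalOrder using (argmin; argmin-all; f[argmin]≤f[xs])
import Data.List.Extrema ℤP.≤-totalOrder as ℤExtrema

infix 8 _·_

_·_ : ∀ {d} → Point d → Point d → ℤ
[] · [] = 0ℤ
(a ∷ as) · (x ∷ xs) = a * x + as · xs

·-distribˡ-⊕ : ∀ {d} (c x y : Point d) → c · (x ⊕ y) ≡ c · x + c · y
·-distribˡ-⊕ [] [] [] = refl
·-distribˡ-⊕ (a ∷ c) (x ∷ xs) (y ∷ ys) rewrite ·-distribˡ-⊕ c xs ys = ring a x y (c · xs) (c · ys)
  where
  ring : ∀ a x y X Y → a * (x + y) + (X + Y) ≡ (a * x + X) + (a * y + Y)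
  ring = solve-∀

·-distribʳ-⊕ : ∀ {d} (c c′ x : Point d) → (c ⊕ c′) · x ≡ c · x + c′ · x
·-distribʳ-⊕ [] [] [] = refl
·-distribʳ-⊕ (a ∷ c) (b ∷ c′) (x ∷ xs) rewrite ·-distribʳ-⊕ c c′ xs = ring a b x (c · xs) (c′ · xs)
  where
  ring : ∀ a b x X Y → (a + b) * x + (X + Y) ≡ (a * x + X) + (b * x + Y)
  ring = solve-∀

⊙-·-assoc : ∀ {d} k (c x : Point d) → (k ⊙ c) · x ≡ k * c · x
⊙-·-assoc k [] [] = sym (ℤP.*-zeroʳ k)
⊙-·-assoc k (a ∷ c) (x ∷ xs) rewrite ⊙-·-assoc k c xs = ring k a x (c · xs)
  where
  ring : ∀ k a x X → k * a * x + k * X ≡ k * (a * x + X)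
  ring = solve-∀

·-⊙-comm : ∀ {d} k (c x : Point d) → c · (k ⊙ x) ≡ k * c · x
·-⊙-comm k [] [] = sym (ℤP.*-zeroʳ k)
·-⊙-comm k (a ∷ c) (x ∷ xs) rewrite ·-⊙-comm k c xs = ring k a x (c · xs)
  where
  ring : ∀ k a x X → a * (k * x) + k * X ≡ k * (a * x + X)
  ring = solve-∀

⊙⊕⊙-· : ∀ {d} α β (c c′ x : Point d) → ((α ⊙ c) ⊕ (β ⊙ c′)) · x ≡ α * c · x + β * c′ · x
⊙⊕⊙-· α β c c′ x =
  trans (·-distribʳ-⊕ (α ⊙ c) (β ⊙ c′) x) (cong₂ _+_ (⊙-·-assoc α c x) (⊙-·-assoc β c′ x))

𝟎-· : ∀ {d} (x : Point d) → 𝟎 · x ≡ 0ℤ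
𝟎-· [] = refl
𝟎-· (x ∷ xs) rewrite 𝟎-· xs = refl

neg : ∀ {d} → Point d → Point d
neg c = (- 1ℤ) ⊙ c

neg-· : ∀ {d} (c x : Point d) → neg c · x ≡ - (c · x)
neg-· c x = trans (⊙-·-assoc (- 1ℤ) c x) (ℤP.-1*i≡-i _)

e : ∀ {d} → Fin d → Point d
e zero = 1ℤ ∷ 𝟎
e (suc i) = 0ℤ ∷ e i

e-· : ∀ {d} (i : Fin d) (x : Point d) → e i · x ≡ lookup x i
e-· zero (x ∷ xs) rewrite 𝟎-· xs = trans (ℤP.+-identityʳ _) (ℤP.*-identityˡ x)
e-· (suc i) (x ∷ xs) rewrite e-· i xs = ℤP.+-identityˡ _

⊕-cancelˡ : ∀ {d} (v : Point d) {x y} → v ⊕ x ≡ v ⊕ y → x ≡ y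
⊕-cancelˡ [] {[]} {[]} _ = refl
⊕-cancelˡ (v ∷ vs) {x ∷ xs} {y ∷ ys} eq =
  cong₂ _∷_ (+-cancelˡ v x y (VP.∷-injectiveˡ eq)) (⊕-cancelˡ vs (VP.∷-injectiveʳ eq))

-- Bounds preserved by the moves

module _ {A : Set} {P : Pred A Level.zero} (P? : Decidable P) where

  length-filter-two-rejected : ∀ xs {x y} → x ≢ y → x Mem.∈ xs → y Mem.∈ xs → ¬ P x → ¬ P y →
                               2 ℕ.+ length (filter P? xs) ℕ.≤ length xs
  length-filter-two-rejected (z ∷ xs) x≢y (here refl) (here refl) _ _ = ⊥-elim (x≢y refl)
  length-filter-two-rejected (z ∷ xs) _ (here refl) (there y∈) ¬Px ¬Py with P? z
  ... | yes Pz = ⊥-elim (¬Px Pz)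
  ... | no _ = s≤s (LP.filter-notAll P? xs (Any.map (λ { refl → ¬Py }) y∈))
  length-filter-two-rejected (z ∷ xs) _ (there x∈) (here refl) ¬Px ¬Py with P? z
  ... | yes Pz = ⊥-elim (¬Py Pz)
  ... | no _ = s≤s (LP.filter-notAll P? xs (Any.map (λ { refl → ¬Px }) x∈))
  length-filter-two-rejected (z ∷ xs) x≢y (there x∈) (there y∈) ¬Px ¬Py with does (P? z)
  ... | true = s≤s (length-filter-two-rejected xs x≢y x∈ y∈ ¬Px ¬Py)
  ... | false = ℕP.m≤n⇒m≤1+n (length-filter-two-rejected xs x≢y x∈ y∈ ¬Px ¬Py)

module _ {d : ℕ} where

  record MaximisedTwice (S : List (Point d)) (c : Point d) : Set where
    field
      {s₁ s₂} : Point d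
      s₁∈S : s₁ ∈ S
      s₂∈S : s₂ ∈ S
      s₁≢s₂ : s₁ ≢ s₂
      tie : c · s₁ ≡ c · s₂
      maximal : ∀ {s} → s ∈ S → c · s ≤ c · s₁

  AlmostFull : List (Point d) → List (Point d) → Point d → Set
  AlmostFull S P v = suc ∣ P ∩ (v +ˢ S) ∣ ≡ length S

  almostFull-meets : ∀ {S P v s₁ s₂} → AlmostFull S P v → s₁ ≢ s₂ → s₁ ∈ S → s₂ ∈ S →
                     v ⊕ s₁ ∈ P ⊎ v ⊕ s₂ ∈ P
  almostFull-meets {S} {P} {v} {s₁} {s₂} full s₁≢s₂ s₁∈ s₂∈ with (v ⊕ s₁) ∈? P | (v ⊕ s₂) ∈? P
  ... | yes p | _ = inj₁ p
  ... | no _ | yes p = inj₂ p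
  ... | no ∉₁ | no ∉₂ = ⊥-elim (ℕP.<-irrefl (trans full (sym (LP.length-map (v ⊕_) S))) two-missing)
    where
    two-missing : 2 ℕ.+ ∣ P ∩ (v +ˢ S) ∣ ℕ.≤ length (v +ˢ S)
    two-missing = length-filter-two-rejected (_∈? P) (v +ˢ S) (s₁≢s₂ ∘ ⊕-cancelˡ v)
                    (MemP.∈-map⁺ (v ⊕_) s₁∈) (MemP.∈-map⁺ (v ⊕_) s₂∈) ∉₁ ∉₂

  BoundedBy : Point d → ℤ → List (Point d) → Set
  BoundedBy c M Q = ∀ {x} → x ∈ Q → c · x ≤ M

  translate-bounded : ∀ {S P c M v} → MaximisedTwice S c → BoundedBy c M P → AlmostFull S P v →
                      BoundedBy c M (v +ˢ S)
  translate-bounded {S} {P} {c} {M} {v} twice bounded full x∈ with MemP.∈-map⁻ (v ⊕_) x∈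
  ... | s , s∈ , refl = ℤP.≤-trans (shift-≤ (maximal s∈)) top-bounded
    where
    open MaximisedTwice twice
    shift-≤ : ∀ {s t} → c · s ≤ c · t → c · (v ⊕ s) ≤ c · (v ⊕ t)
    shift-≤ {s} {t} le rewrite ·-distribˡ-⊕ c v s | ·-distribˡ-⊕ c v t = ℤP.+-monoʳ-≤ (c · v) le
    top-bounded : c · (v ⊕ s₁) ≤ M
    top-bounded with almostFull-meets full s₁≢s₂ s₁∈S s₂∈S
    ... | inj₁ p = bounded p
    ... | inj₂ p = ℤP.≤-trans (shift-≤ (ℤP.≤-reflexive tie)) (bounded p)

  Expands : List (Point d) → List (Point d) → List (Point d) → Set
  Expands S P Q = ∀ {x} → x ∈ Q → x ∈ P ⊎ ∃[ v ] (AlmostFull S P v × x ∈ v +ˢ S)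

  fillMove⇒expands : ∀ {S P Q} → FillMove S P Q → Expands S P Q
  fillMove⇒expands {P = P} (v , full , refl) x∈ with MemP.∈-++⁻ P x∈
  ... | inj₁ x∈P = inj₁ x∈P
  ... | inj₂ x∈v+S = inj₂ (v , full , x∈v+S)

  solMove⇒expands : ∀ {S P Q} → SolMove S P Q → Expands S P Q
  solMove⇒expands {P = P} (v , x , y , _ , x∈ , y∈ , full , _ , △≡xy) {z} z∈Q with z ∈? P
  ... | yes z∈P = inj₁ z∈P
  ... | no z∉P with Equivalence.to (△≡xy z) (inj₂ (z∉P , z∈Q))
  ... | inj₁ refl = inj₂ (v , full , x∈)
  ... | inj₂ refl = inj₂ (v , full , y∈)

  expands-bounded : ∀ {S P Q c M} → MaximisedTwice S c → Expands S P Q → BoundedBy c M P → BoundedBy c M Q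
  expands-bounded twice expands bounded x∈ with expands x∈
  ... | inj₁ x∈P = bounded x∈P
  ... | inj₂ (v , full , x∈v+S) = translate-bounded twice bounded full x∈v+S

  star-bounded : ∀ {S c M} {R : List (Point d) → List (Point d) → Set} →
                 (∀ {P Q} → R P Q → Expands S P Q) → MaximisedTwice S c →
                 ∀ {P Q} → Star R P Q → BoundedBy c M P → BoundedBy c M Q
  star-bounded {c = c} {M} moves twice =
    Star.fold (λ P Q → BoundedBy c M P → BoundedBy c M Q) (λ step k → k ∘ expands-bounded twice (moves step)) id

-- Reachable configurations lie in a box

i≤+∣i∣ : ∀ i → i ≤ + ℤ.∣ i ∣
i≤+∣i∣ (+ n) = ℤP.≤-refl
i≤+∣i∣ -[1+ n ] = ℤ.-≤+

∣i∣≤⊔ : ∀ i {a b} → i ≤ + a → - i ≤ + b → ℤ.∣ i ∣ ℕ.≤ a ℕ.⊔ b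
∣i∣≤⊔ (+ n) {a} {b} (ℤ.+≤+ n≤a) _ = ℕP.≤-trans n≤a (ℕP.m≤m⊔n a b)
∣i∣≤⊔ -[1+ n ] {a} {b} _ (ℤ.+≤+ n≤b) = ℕP.≤-trans n≤b (ℕP.m≤n⊔m a b)

positive-combination-≤ : ∀ l₁ l₂ m M₁ M₂ {a₁ a₂ y} → + l₁ * a₁ + + l₂ * a₂ ≡ + suc m * y →
                         a₁ ≤ + M₁ → a₂ ≤ + M₂ → y ≤ + (l₁ ℕ.* M₁ ℕ.+ l₂ ℕ.* M₂)
positive-combination-≤ l₁ l₂ m M₁ M₂ {y = -[1+ n ]} _ _ _ = ℤ.-≤+
positive-combination-≤ l₁ l₂ m M₁ M₂ {a₁} {a₂} {+ n} eq a₁≤ a₂≤ = begin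
  + n                       ≤⟨ ℤ.+≤+ (ℕP.m≤n*m n (suc m)) ⟩
  + (suc m ℕ.* n)           ≡⟨ ℤP.pos-* (suc m) n ⟩
  + suc m * + n             ≡⟨ sym eq ⟩
  + l₁ * a₁ + + l₂ * a₂     ≤⟨ ℤP.+-mono-≤ (ℤP.*-monoˡ-≤-nonNeg (+ l₁) a₁≤) (ℤP.*-monoˡ-≤-nonNeg (+ l₂) a₂≤) ⟩
  + l₁ * + M₁ + + l₂ * + M₂ ≡⟨ sym (cong₂ _+_ (ℤP.pos-* l₁ M₁) (ℤP.pos-* l₂ M₂)) ⟩
  + (l₁ ℕ.* M₁) + + (l₂ ℕ.* M₂) ≡⟨ sym (ℤP.pos-+ (l₁ ℕ.* M₁) (l₂ ℕ.* M₂)) ⟩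
  + (l₁ ℕ.* M₁ ℕ.+ l₂ ℕ.* M₂) ∎
  where open ℤP.≤-Reasoning

range : ℕ → List ℤ
range b = map +_ (L.upTo (suc b)) ++ map -[1+_] (L.upTo b)

∈-range : ∀ {b} z → ℤ.∣ z ∣ ℕ.≤ b → z Mem.∈ range b
∈-range (+ n) n≤b = MemP.∈-++⁺ˡ (MemP.∈-map⁺ +_ (MemP.∈-upTo⁺ (s≤s n≤b)))
∈-range {b} -[1+ n ] n<b = MemP.∈-++⁺ʳ (map +_ (L.upTo (suc b))) (MemP.∈-map⁺ -[1+_] (MemP.∈-upTo⁺ n<b))

box : ∀ {d} → (Fin d → ℕ) → List (Point d)
box {zero} B = [] ∷ []
box {suc d} B = L.concatMap (λ z → map (z ∷_) (box (B ∘ suc))) (range (B zero))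

∈-box : ∀ {d} {B : Fin d → ℕ} (x : Point d) → (∀ j → ℤ.∣ lookup x j ∣ ℕ.≤ B j) → x ∈ box B
∈-box [] _ = here refl
∈-box {B = B} (z ∷ xs) bounded = MemP.∈-concatMap⁺ (λ z → map (z ∷_) (box (B ∘ suc))) {xs = range (B zero)}
  (Any.map (λ { refl → MemP.∈-map⁺ (z ∷_) (∈-box xs (bounded ∘ suc)) }) (∈-range z (bounded zero)))

sublists : ∀ {A : Set} → List A → List (List A)
sublists [] = [] ∷ []
sublists (x ∷ xs) = map (x ∷_) (sublists xs) ++ sublists xs

filter∈sublists : ∀ {A : Set} {P : Pred A Level.zero} (P? : Decidable P) xs → filter P? xs Mem.∈ sublists xs
filter∈sublists P? [] = here refl
filter∈sublists P? (x ∷ xs) with does (P? x)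
... | true = MemP.∈-++⁺ˡ (MemP.∈-map⁺ (x ∷_) (filter∈sublists P? xs))
... | false = MemP.∈-++⁺ʳ (map (x ∷_) (sublists xs)) (filter∈sublists P? xs)

module _ {d : ℕ} where

  record InCone (S : List (Point d)) (c : Point d) : Set where
    field
      {c₁ c₂} : Point d
      l₁ l₂ m : ℕ
      max₁ : MaximisedTwice S c₁
      max₂ : MaximisedTwice S c₂
      combination : ∀ x → + l₁ * c₁ · x + + l₂ * c₂ · x ≡ + suc m * c · x

  ·-bound : Point d → List (Point d) → ℕ
  ·-bound c [] = 0
  ·-bound c (p ∷ P) = ℤ.∣ c · p ∣ ℕ.+ ·-bound c P

  ·-bounded : ∀ c P → BoundedBy c (+ ·-bound c P) P
  ·-bounded c (p ∷ P) (here refl) =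
    ℤP.≤-trans (i≤+∣i∣ (c · p)) (ℤ.+≤+ (ℕP.m≤m+n ℤ.∣ c · p ∣ (·-bound c P)))
  ·-bounded c (p ∷ P) (there x∈) =
    ℤP.≤-trans (·-bounded c P x∈) (ℤ.+≤+ (ℕP.m≤n+m (·-bound c P) ℤ.∣ c · p ∣))

  coneBound : ∀ {S c} → InCone S c → List (Point d) → ℕ
  coneBound cone P = l₁ ℕ.* ·-bound c₁ P ℕ.+ l₂ ℕ.* ·-bound c₂ P
    where open InCone cone

  star-cone-bounded : ∀ {S} {R : List (Point d) → List (Point d) → Set} → (∀ {P Q} → R P Q → Expands S P Q) →
                      ∀ {c P Q} (cone : InCone S c) → Star R P Q → BoundedBy c (+ coneBound cone P) Q
  star-cone-bounded moves {P = P} cone steps x∈ =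
    positive-combination-≤ l₁ l₂ m (·-bound c₁ P) (·-bound c₂ P) (combination _)
      (star-bounded moves max₁ steps (·-bounded c₁ P) x∈)
      (star-bounded moves max₂ steps (·-bounded c₂ P) x∈)
    where open InCone cone

module _ {d : ℕ} {S : List (Point d)} (cones : ∀ j → InCone S (e j) × InCone S (neg (e j))) where

  coordinateBound : List (Point d) → Fin d → ℕ
  coordinateBound P j = coneBound (proj₁ (cones j)) P ℕ.⊔ coneBound (proj₂ (cones j)) P

  star-⊆-box : ∀ {R : List (Point d) → List (Point d) → Set} → (∀ {P Q} → R P Q → Expands S P Q) →
               ∀ {P Q x} → Star R P Q → x ∈ Q → x ∈ box (coordinateBound P)
  star-⊆-box moves {x = x} steps x∈ = ∈-box x λ j →
    ∣i∣≤⊔ (lookup x j) (subst (_≤ _) (e-· j x) (star-cone-bounded moves (proj₁ (cones j)) steps x∈))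
                       (subst (_≤ _) (-e-· j) (star-cone-bounded moves (proj₂ (cones j)) steps x∈))
    where
    -e-· : ∀ j → neg (e j) · x ≡ - lookup x j
    -e-· j = trans (neg-· (e j) x) (cong -_ (e-· j x))

  finiteClosure : ∀ P → FiniteClosure S P
  finiteClosure P = box (coordinateBound P) ,
    λ { x (Q , steps , x∈Q) → star-⊆-box fillMove⇒expands steps x∈Q }

  finiteOrbit : ∀ P → FiniteOrbit S P
  finiteOrbit P = sublists (box (coordinateBound P)) , λ Q steps →
    filter (_∈? Q) (box (coordinateBound P)) , filter∈sublists (_∈? Q) (box (coordinateBound P)) ,
    λ z → record
      { to = λ z∈Q → MemP.∈-filter⁺ (_∈? Q) (star-⊆-box solMove⇒expands steps z∈Q) z∈Q
      ; from = λ z∈ → proj₂ (MemP.∈-filter⁻ (_∈? Q) {xs = box (coordinateBound P)} z∈)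
      ; to-cong = λ { refl → refl }
      ; from-cong = λ { refl → refl }
      }

-- Tilting a functional until it is maximised twice

i<j⇒0<j-i : ∀ {i j} → i < j → 0ℤ < j - i
i<j⇒0<j-i {i} {j} i<j = subst (_< j - i) (ℤP.+-inverseʳ i) (ℤP.+-monoˡ-< (- i) i<j)

0<j-i⇒i<j : ∀ {i j} → 0ℤ < j - i → i < j
0<j-i⇒i<j {i} {j} 0<j-i = subst₂ _<_ (ℤP.+-identityˡ i) (ring j i) (ℤP.+-monoˡ-< i 0<j-i)
  where
  ring : ∀ j i → j - i + i ≡ j
  ring = solve-∀

0<i⇒+suc-pred∣i∣ : ∀ {i} → 0ℤ < i → + suc (ℕ.pred ℤ.∣ i ∣) ≡ i
0<i⇒+suc-pred∣i∣ {+[1+ n ]} _ = refl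
0<i⇒+suc-pred∣i∣ {+ zero} (ℤ.+<+ ())

tilted-≡ : ∀ {a b} C₀ C₁ U₀ U₁ → a ≡ C₀ - C₁ → b ≡ U₁ - U₀ → b * C₀ + a * U₀ ≡ b * C₁ + a * U₁
tilted-≡ C₀ C₁ U₀ U₁ refl refl = ring C₀ C₁ U₀ U₁
  where
  ring : ∀ C₀ C₁ U₀ U₁ → (U₁ - U₀) * C₀ + (C₀ - C₁) * U₀ ≡ (U₁ - U₀) * C₁ + (C₀ - C₁) * U₁
  ring = solve-∀

tilted-≤ : ∀ a b C₀ C U₀ U → a * (U - U₀) ≤ (C₀ - C) * b → b * C + a * U ≤ b * C₀ + a * U₀
tilted-≤ a b C₀ C U₀ U le =
  ℤP.0≤i-j⇒j≤i (subst (0ℤ ≤_) (ring a b C₀ C U₀ U) (ℤP.i≤j⇒0≤j-i le))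
  where
  ring : ∀ a b C₀ C U₀ U → (C₀ - C) * b - a * (U - U₀) ≡ (b * C₀ + a * U₀) - (b * C + a * U)
  ring = solve-∀

module _ {d : ℕ} where

  record TiltedTowards (S : List (Point d)) (c u : Point d) : Set where
    field
      {c′} : Point d
      a b : ℕ
      maxTwice : MaximisedTwice S c′
      decomposition : ∀ x → c′ · x ≡ + suc b * c · x + + a * u · x

  -- The second maximiser is a point s above s₀ in direction u minimising the slope
  -- (c·s₀ − c·s) / (u·s − u·s₀); `slope s` has that denominator only for such s, the only
  -- ones ever compared.
  tilt : ∀ {S c u s₀ s⁺} → s₀ ∈ S → (∀ {s} → s ∈ S → c · s ≤ c · s₀) → s⁺ ∈ S → u · s₀ < u · s⁺ →
         TiltedTowards S c u
  tilt {S} {c} {u} {s₀} {s⁺} s₀∈S s₀-max s⁺∈S s⁺-above = record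
    { c′ = c′ ; a = a ; b = b ; decomposition = decomposition
    ; maxTwice = record
      { s₁ = s₀ ; s₂ = s* ; s₁∈S = s₀∈S ; s₂∈S = s*∈S ; s₁≢s₂ = λ eq → ℤP.<-irrefl (cong (u ·_) eq) s*-above
      ; tie = tie ; maximal = maximal } }
    where
    above? : Decidable (λ s → u · s₀ < u · s)
    above? s = u · s₀ ℤ.<? u · s
    slope : Point d → ℚᵘ
    slope s = mkℚᵘ (c · s₀ - c · s) (ℕ.pred ℤ.∣ u · s - u · s₀ ∣)
    Above : List (Point d)
    Above = filter above? S
    s* : Point d
    s* = argmin slope s⁺ Above
    s*∈S×above : s* ∈ S × u · s₀ < u · s*
    s*∈S×above = argmin-all slope (s⁺∈S , s⁺-above) (All.tabulate (MemP.∈-filter⁻ above? {xs = S}))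
    s*∈S : s* ∈ S
    s*∈S = proj₁ s*∈S×above
    s*-above : u · s₀ < u · s*
    s*-above = proj₂ s*∈S×above
    a b : ℕ
    a = ℤ.∣ c · s₀ - c · s* ∣
    b = ℕ.pred ℤ.∣ u · s* - u · s₀ ∣
    a≡ : + a ≡ c · s₀ - c · s*
    a≡ = ℤP.0≤i⇒+∣i∣≡i (ℤP.i≤j⇒0≤j-i (s₀-max s*∈S))
    b≡ : + suc b ≡ u · s* - u · s₀
    b≡ = 0<i⇒+suc-pred∣i∣ (i<j⇒0<j-i s*-above)
    c′ : Point d
    c′ = ((+ suc b) ⊙ c) ⊕ ((+ a) ⊙ u)
    decomposition : ∀ x → c′ · x ≡ + suc b * c · x + + a * u · x
    decomposition = ⊙⊕⊙-· (+ suc b) (+ a) c u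
    tie : c′ · s₀ ≡ c′ · s*
    tie = trans (decomposition s₀)
                (trans (tilted-≡ (c · s₀) (c · s*) (u · s₀) (u · s*) a≡ b≡) (sym (decomposition s*)))
    steep-enough : ∀ {s} → s ∈ S → + a * (u · s - u · s₀) ≤ (c · s₀ - c · s) * + suc b
    steep-enough {s} s∈S with above? s
    ... | yes s-above with All.lookup (f[argmin]≤f[xs] {f = slope} s⁺ Above) (MemP.∈-filter⁺ above? s∈S s-above)
    ...   | *≤* slopes = subst (_≤ (c · s₀ - c · s) * + suc b)
                               (cong₂ _*_ (sym a≡) (0<i⇒+suc-pred∣i∣ (i<j⇒0<j-i s-above))) slopes
    steep-enough {s} s∈S | no s-below = begin
      + a * (u · s - u · s₀)    ≤⟨ ℤP.*-monoˡ-≤-nonNeg (+ a) (ℤP.i≤j⇒i-j≤0 (ℤP.≮⇒≥ s-below)) ⟩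
      + a * 0ℤ                  ≡⟨ ℤP.*-zeroʳ (+ a) ⟩
      0ℤ * + suc b              ≤⟨ ℤP.*-monoʳ-≤-nonNeg (+ suc b) (ℤP.i≤j⇒0≤j-i (s₀-max s∈S)) ⟩
      (c · s₀ - c · s) * + suc b ∎
      where open ℤP.≤-Reasoning
    maximal : ∀ {s} → s ∈ S → c′ · s ≤ c′ · s₀
    maximal {s} s∈S = subst₂ _≤_ (sym (decomposition s)) (sym (decomposition s₀))
                        (tilted-≤ (+ a) (+ suc b) (c · s₀) (c · s) (u · s₀) (u · s) (steep-enough s∈S))

+l*+k++[1+n]*+[1+p] : ∀ l k n p → + l * + k + + suc n * + suc p ≡ + suc (l ℕ.* k ℕ.+ (p ℕ.+ n ℕ.* suc p))
+l*+k++[1+n]*+[1+p] l k n p = begin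
  + l * + k + + suc n * + suc p                ≡⟨ sym (cong₂ _+_ (ℤP.pos-* l k) (ℤP.pos-* (suc n) (suc p))) ⟩
  + (l ℕ.* k) + + (suc n ℕ.* suc p)           ≡⟨ sym (ℤP.pos-+ (l ℕ.* k) (suc n ℕ.* suc p)) ⟩
  + (l ℕ.* k ℕ.+ suc (p ℕ.+ n ℕ.* suc p))     ≡⟨ cong +_ (ℕP.+-suc (l ℕ.* k) (p ℕ.+ n ℕ.* suc p)) ⟩
  + suc (l ℕ.* k ℕ.+ (p ℕ.+ n ℕ.* suc p))     ∎
  where open ≡-Reasoning

module _ {d : ℕ} where

  -- From c′ = b c + a u and c″ = b′ c + a′ (−u), a′ c′ + a c″ is a positive multiple of c
  -- (and if a = 0, c′ alone is).
  cone-of-tilts : ∀ {S : List (Point d)} {c u} → TiltedTowards S c u → TiltedTowards S c (neg u) → InCone S c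
  cone-of-tilts {S} {c} {u} t⁺@record { a = zero } _ = record
    { l₁ = 1 ; l₂ = 0 ; m = b ; max₁ = maxTwice ; max₂ = maxTwice ; combination = combination }
    where
    open TiltedTowards t⁺
    combination : ∀ x → + 1 * c′ · x + + 0 * c′ · x ≡ + suc b * c · x
    combination x rewrite decomposition x = ring (+ suc b) (c · x) (u · x)
      where
      ring : ∀ B C U → + 1 * (B * C + + 0 * U) + + 0 * (B * C + + 0 * U) ≡ B * C
      ring = solve-∀
  cone-of-tilts {S} {c} {u} t⁺@record { a = suc a₀ } t⁻ = record
    { l₁ = T⁻.a ; l₂ = suc a₀ ; m = T⁻.a ℕ.* suc T⁺.b ℕ.+ (T⁻.b ℕ.+ a₀ ℕ.* suc T⁻.b)
    ; max₁ = T⁺.maxTwice ; max₂ = T⁻.maxTwice ; combination = combination }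
    where
    module T⁺ = TiltedTowards t⁺
    module T⁻ = TiltedTowards t⁻
    combination : ∀ x → + T⁻.a * T⁺.c′ · x + + suc a₀ * T⁻.c′ · x ≡
                        + suc (T⁻.a ℕ.* suc T⁺.b ℕ.+ (T⁻.b ℕ.+ a₀ ℕ.* suc T⁻.b)) * c · x
    combination x rewrite T⁺.decomposition x | T⁻.decomposition x | neg-· u x =
      trans (ring (+ T⁻.a) (+ suc a₀) (+ suc T⁺.b) (+ suc T⁻.b) (c · x) (u · x))
            (cong (_* c · x) (+l*+k++[1+n]*+[1+p] T⁻.a (suc T⁺.b) a₀ T⁻.b))
      where
      ring : ∀ A A₀ B B′ C U → A * (B * C + A₀ * U) + A₀ * (B′ * C + A * - U) ≡ (A * B + A₀ * B′) * C
      ring = solve-∀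

-- Points straddled by a nonvanishing minor

module _ {d : ℕ} where

  record Straddle (S : List (Point d)) (s₀ : Point d) : Set where
    field
      u : Point d
      {s⁺ s⁻} : Point d
      s⁺∈S : s⁺ ∈ S
      s⁻∈S : s⁻ ∈ S
      above : u · s₀ < u · s⁺
      below : u · s⁻ < u · s₀

  minor : Point d → Point d → Point d → Fin d → Fin d → ℤ
  minor s₀ s₁ s₂ i k = (lookup s₁ i - lookup s₀ i) * (lookup s₂ k - lookup s₀ k)
                     - (lookup s₁ k - lookup s₀ k) * (lookup s₂ i - lookup s₀ i)

  minor-swap : ∀ s₀ s₁ s₂ i k → minor s₀ s₂ s₁ i k ≡ - minor s₀ s₁ s₂ i k
  minor-swap s₀ s₁ s₂ i k =
    ring (lookup s₀ i) (lookup s₀ k) (lookup s₁ i) (lookup s₁ k) (lookup s₂ i) (lookup s₂ k)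
    where
    ring : ∀ a₀ b₀ a₁ b₁ a₂ b₂ → (a₂ - a₀) * (b₁ - b₀) - (b₂ - b₀) * (a₁ - a₀)
                                  ≡ - ((a₁ - a₀) * (b₂ - b₀) - (b₁ - b₀) * (a₂ - a₀))
    ring = solve-∀

  -- With u = α eᵢ + β eₖ as below, both u·(s₁ − s₀) and u·(s₀ − s₂) equal the minor.
  positive-minor⇒straddle : ∀ {S s₀ s₁ s₂} i k → s₁ ∈ S → s₂ ∈ S → 0ℤ < minor s₀ s₁ s₂ i k → Straddle S s₀
  positive-minor⇒straddle {S} {s₀} {s₁} {s₂} i k s₁∈S s₂∈S 0<m = record
    { u = u ; s⁺∈S = s₁∈S ; s⁻∈S = s₂∈S
    ; above = 0<j-i⇒i<j (subst (0ℤ <_) (sym (trans (cong₂ _-_ (u-· s₁) (u-· s₀)) (ring₁ a₀ b₀ a₁ b₁ a₂ b₂))) 0<m)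
    ; below = 0<j-i⇒i<j (subst (0ℤ <_) (sym (trans (cong₂ _-_ (u-· s₀) (u-· s₂)) (ring₂ a₀ b₀ a₁ b₁ a₂ b₂))) 0<m)
    }
    where
    a₀ b₀ a₁ b₁ a₂ b₂ α β : ℤ
    a₀ = lookup s₀ i ; b₀ = lookup s₀ k ; a₁ = lookup s₁ i ; b₁ = lookup s₁ k ; a₂ = lookup s₂ i ; b₂ = lookup s₂ k
    α = (b₂ - b₀) + (b₁ - b₀)
    β = - ((a₂ - a₀) + (a₁ - a₀))
    u : Point d
    u = (α ⊙ e i) ⊕ (β ⊙ e k)
    u-· : ∀ x → u · x ≡ α * lookup x i + β * lookup x k
    u-· x = trans (⊙⊕⊙-· α β (e i) (e k) x) (cong₂ (λ p q → α * p + β * q) (e-· i x) (e-· k x))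
    ring₁ : ∀ a₀ b₀ a₁ b₁ a₂ b₂ → let α = (b₂ - b₀) + (b₁ - b₀) ; β = - ((a₂ - a₀) + (a₁ - a₀)) in
            (α * a₁ + β * b₁) - (α * a₀ + β * b₀) ≡ (a₁ - a₀) * (b₂ - b₀) - (b₁ - b₀) * (a₂ - a₀)
    ring₁ = solve-∀
    ring₂ : ∀ a₀ b₀ a₁ b₁ a₂ b₂ → let α = (b₂ - b₀) + (b₁ - b₀) ; β = - ((a₂ - a₀) + (a₁ - a₀)) in
            (α * a₀ + β * b₀) - (α * a₂ + β * b₂) ≡ (a₁ - a₀) * (b₂ - b₀) - (b₁ - b₀) * (a₂ - a₀)
    ring₂ = solve-∀

  minor≢0⇒straddle : ∀ {S s₀ s₁ s₂} i k → s₁ ∈ S → s₂ ∈ S → minor s₀ s₁ s₂ i k ≢ 0ℤ → Straddle S s₀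
  minor≢0⇒straddle {S} {s₀} {s₁} {s₂} i k s₁∈S s₂∈S m≢0 with ℤP.<-cmp (minor s₀ s₁ s₂ i k) 0ℤ
  ... | tri< m<0 _ _ = positive-minor⇒straddle i k s₂∈S s₁∈S
                         (subst (0ℤ <_) (sym (minor-swap s₀ s₁ s₂ i k)) (ℤP.neg-mono-< m<0))
  ... | tri≈ _ m≡0 _ = ⊥-elim (m≢0 m≡0)
  ... | tri> _ _ 0<m = positive-minor⇒straddle i k s₁∈S s₂∈S 0<m

find-or-all : ∀ {A : Set} {W N : A → Set} (xs : List A) → (∀ x → W x ⊎ N x) →
              (∃[ x ] (x Mem.∈ xs × W x)) ⊎ (∀ {x} → x Mem.∈ xs → N x)
find-or-all [] w⊎n = inj₂ λ ()
find-or-all (x ∷ xs) w⊎n with w⊎n x | find-or-all xs w⊎n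
... | inj₁ w | _ = inj₁ (x , here refl , w)
... | inj₂ _ | inj₁ (y , y∈ , w) = inj₁ (y , there y∈ , w)
... | inj₂ n | inj₂ ns = inj₂ λ { (here refl) → n ; (there y∈) → ns y∈ }

find-or-allFin : ∀ {n} {W N : Fin n → Set} → (∀ i → W i ⊎ N i) → (∃[ i ] W i) ⊎ (∀ i → N i)
find-or-allFin {n} w⊎n with find-or-all (L.allFin n) w⊎n
... | inj₁ (i , _ , w) = inj₁ (i , w)
... | inj₂ ns = inj₂ λ i → ns (MemP.∈-allFin i)

module _ {d : ℕ} where

  AllMinorsVanish : List (Point d) → Point d → Set
  AllMinorsVanish S s₀ = ∀ {s₁} → s₁ ∈ S → ∀ {s₂} → s₂ ∈ S → ∀ i k → minor s₀ s₁ s₂ i k ≡ 0ℤ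

  NonvanishingMinor : List (Point d) → Point d → Set
  NonvanishingMinor S s₀ = ∃[ s₁ ] (s₁ ∈ S × ∃[ s₂ ] (s₂ ∈ S × ∃[ i ] ∃[ k ] minor s₀ s₁ s₂ i k ≢ 0ℤ))

  nonvanishingMinor-or-allMinorsVanish : ∀ S s₀ → NonvanishingMinor S s₀ ⊎ AllMinorsVanish S s₀
  nonvanishingMinor-or-allMinorsVanish S s₀ =
    find-or-all S λ s₁ → find-or-all S λ s₂ → find-or-allFin λ i → find-or-allFin λ k →
      Sum.swap (toSum (minor s₀ s₁ s₂ i k ℤ.≟ 0ℤ))

-- Collinear sets are linear

record GcdWitness (x : ℤ) (n : ℕ) : Set where
  field
    g : ℕ
    α β : ℤ
    bézout : α * x + β * + n ≡ + g
    x/g n/g : ℤ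
    x≡ : x ≡ x/g * + g
    n≡ : + n ≡ n/g * + g

ℕ-identity⇒ℤ : ∀ g b n a m → g ℕ.+ b ℕ.* n ≡ a ℕ.* m → + a * + m - + b * + n ≡ + g
ℕ-identity⇒ℤ g b n a m eq = begin
  + a * + m - + b * + n                 ≡⟨ cong (_- + b * + n) (sym (ℤP.pos-* a m)) ⟩
  + (a ℕ.* m) - + b * + n               ≡⟨ cong (λ k → + k - + b * + n) (sym eq) ⟩
  + (g ℕ.+ b ℕ.* n) - + b * + n         ≡⟨ cong (_- + b * + n) (ℤP.pos-+ g (b ℕ.* n)) ⟩
  + g + + (b ℕ.* n) - + b * + n         ≡⟨ cong (λ k → + g + k - + b * + n) (ℤP.pos-* b n) ⟩
  + g + + b * + n - + b * + n           ≡⟨ ring (+ g) (+ b * + n) ⟩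
  + g                                   ∎
  where
  open ≡-Reasoning
  ring : ∀ G Y → G + Y - Y ≡ G
  ring = solve-∀

identity⇒ℤ : ∀ {g m n} → Bézout.Identity g m n → ∃[ α ] ∃[ β ] (α * + m + β * + n ≡ + g)
identity⇒ℤ {g} {m} {n} (Bézout.+- a b eq) =
  + a , - + b , trans (ring (+ a) (+ m) (+ b) (+ n)) (ℕ-identity⇒ℤ g b n a m eq)
  where
  ring : ∀ a m b n → a * m + - b * n ≡ a * m - b * n
  ring = solve-∀
identity⇒ℤ {g} {m} {n} (Bézout.-+ a b eq) =
  - + a , + b , trans (ring (+ a) (+ m) (+ b) (+ n)) (ℕ-identity⇒ℤ g a m b n eq)
  where
  ring : ∀ a m b n → - a * m + b * n ≡ b * n - a * m
  ring = solve-∀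

∣i∣≡σ*i : ∀ i → ∃[ σ ] (+ ℤ.∣ i ∣ ≡ σ * i × i ≡ σ * + ℤ.∣ i ∣)
∣i∣≡σ*i (+ n) = 1ℤ , sym (ℤP.*-identityˡ _) , sym (ℤP.*-identityˡ _)
∣i∣≡σ*i -[1+ n ] = - 1ℤ , sym (ℤP.-1*i≡-i -[1+ n ]) , sym (ℤP.-1*i≡-i (+ suc n))

∣⇒+≡+quotient* : ∀ {g m} (g∣m : g ∣ m) → + m ≡ + _∣_.quotient g∣m * + g
∣⇒+≡+quotient* {g} g∣m = trans (cong +_ (_∣_.equality g∣m)) (ℤP.pos-* (_∣_.quotient g∣m) g)

gcdWitness : ∀ x n → GcdWitness x n
gcdWitness x n with ∣i∣≡σ*i x | identity⇒ℤ (Bézout.identity (gcd-GCD ℤ.∣ x ∣ n))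
... | σ , ∣x∣≡σx , x≡σ∣x∣ | α , β , identity = record
  { g = g ; α = α * σ ; β = β ; bézout = bézout
  ; x/g = σ * + _∣_.quotient g∣x ; n/g = + _∣_.quotient g∣n ; x≡ = x≡ ; n≡ = ∣⇒+≡+quotient* g∣n }
  where
  g : ℕ
  g = gcd ℤ.∣ x ∣ n
  g∣x : g ∣ ℤ.∣ x ∣
  g∣x = gcd[m,n]∣m ℤ.∣ x ∣ n
  g∣n : g ∣ n
  g∣n = gcd[m,n]∣n ℤ.∣ x ∣ n
  bézout : α * σ * x + β * + n ≡ + g
  bézout = trans (cong (_+ β * + n) (trans (ℤP.*-assoc α σ x) (cong (α *_) (sym ∣x∣≡σx)))) identity
  x≡ : x ≡ σ * + _∣_.quotient g∣x * + g
  x≡ = trans x≡σ∣x∣ (trans (cong (σ *_) (∣⇒+≡+quotient* g∣x)) (sym (ℤP.*-assoc σ _ (+ g))))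

record VecGcdWitness {d} (w : Point d) : Set where
  field
    g : ℕ
    coeffs : Point d
    bézout : coeffs · w ≡ + g
    quotient : Fin d → ℤ
    divides : ∀ l → lookup w l ≡ quotient l * + g

vecGcdWitness : ∀ {d} (w : Point d) → VecGcdWitness w
vecGcdWitness [] = record { g = 0 ; coeffs = [] ; bézout = refl ; quotient = λ () ; divides = λ () }
vecGcdWitness (w₀ ∷ ws) = record
  { g = g ; coeffs = α ∷ (β ⊙ W.coeffs) ; quotient = quotient ; divides = divides
  ; bézout = trans (cong (λ k → α * w₀ + k) (trans (⊙-·-assoc β W.coeffs ws) (cong (β *_) W.bézout))) bézout }
  where
  module W = VecGcdWitness (vecGcdWitness ws)
  open GcdWitness (gcdWitness w₀ W.g)
  quotient : Fin _ → ℤ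
  quotient zero = x/g
  quotient (suc l) = W.quotient l * n/g
  divides : ∀ l → lookup (w₀ ∷ ws) l ≡ quotient l * + g
  divides zero = x≡
  divides (suc l) =
    trans (W.divides l) (trans (cong (W.quotient l *_) n≡) (sym (ℤP.*-assoc (W.quotient l) n/g (+ g))))

_⊖_ : ∀ {d} → Point d → Point d → Point d
_⊖_ = V.zipWith _-_

lookup-⊖ : ∀ {d} (x y : Point d) l → lookup (x ⊖ y) l ≡ lookup x l - lookup y l
lookup-⊖ x y l = VP.lookup-zipWith _-_ l x y

lookup-ext : ∀ {d} {x y : Point d} → (∀ l → lookup x l ≡ lookup y l) → x ≡ y
lookup-ext {x = x} {y} eq =
  trans (sym (VP.tabulate∘lookup x)) (trans (VP.tabulate-cong eq) (VP.tabulate∘lookup y))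

x≡x⊕0⊙b : ∀ {d} (x b : Point d) → x ≡ x ⊕ (0ℤ ⊙ b)
x≡x⊕0⊙b [] [] = refl
x≡x⊕0⊙b (x ∷ xs) (b ∷ bs) = cong₂ _∷_ (sym (ℤP.+-identityʳ x)) (x≡x⊕0⊙b xs bs)

e₀≢𝟎 : ∀ {d} → e {suc d} zero ≢ 𝟎
e₀≢𝟎 ()

module _ {d : ℕ} {S : List (Point d)} {s₀ s₁ : Point d}
         (s₁∈S : s₁ ∈ S) (s₁≢s₀ : s₁ ≢ s₀) (vanish : AllMinorsVanish S s₀) where

  private
    w : Point d
    w = s₁ ⊖ s₀
    open VecGcdWitness (vecGcdWitness w)

    w≢𝟎 : ¬ (∀ l → lookup w l ≡ 0ℤ)
    w≢𝟎 w≡𝟎 = s₁≢s₀ (lookup-ext λ l → ℤP.i-j≡0⇒i≡j _ _ (trans (sym (lookup-⊖ s₁ s₀ l)) (w≡𝟎 l)))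

    instance
      g≢0 : ℤ.NonZero (+ g)
      g≢0 = ℤ.≢-nonZero λ g≡0 →
        w≢𝟎 λ l → trans (divides l) (trans (cong (quotient l *_) g≡0) (ℤP.*-zeroʳ (quotient l)))

    parallel : ∀ {s} → s ∈ S → ∀ l → lookup (s ⊖ s₀) l ⊙ w ≡ lookup w l ⊙ (s ⊖ s₀)
    parallel {s} s∈S l = lookup-ext λ m → begin
      lookup (lookup (s ⊖ s₀) l ⊙ w) m   ≡⟨ VP.lookup-map m _ w ⟩
      lookup (s ⊖ s₀) l * lookup w m       ≡⟨ cong₂ _*_ (lookup-⊖ s s₀ l) (lookup-⊖ s₁ s₀ m) ⟩
      (lookup s l - lookup s₀ l) * (lookup s₁ m - lookup s₀ m)
        ≡⟨ ℤP.i-j≡0⇒i≡j _ _ (trans (ring (lookup s₀ l) (lookup s₀ m) (lookup s₁ l) (lookup s₁ m)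
                                         (lookup s l) (lookup s m))
                                   (vanish s₁∈S s∈S m l)) ⟩
      (lookup s₁ l - lookup s₀ l) * (lookup s m - lookup s₀ m)
        ≡⟨ sym (cong₂ _*_ (lookup-⊖ s₁ s₀ l) (lookup-⊖ s s₀ m)) ⟩
      lookup w l * lookup (s ⊖ s₀) m       ≡⟨ sym (VP.lookup-map m _ (s ⊖ s₀)) ⟩
      lookup (lookup w l ⊙ (s ⊖ s₀)) m   ∎
      where
      open ≡-Reasoning
      ring : ∀ a₀ b₀ a₁ b₁ a b → (a - a₀) * (b₁ - b₀) - (a₁ - a₀) * (b - b₀)
                                  ≡ (b₁ - b₀) * (a - a₀) - (a₁ - a₀) * (b - b₀)
      ring = solve-∀

    coordinate : ∀ {s} → s ∈ S → ∀ l → lookup (s ⊖ s₀) l ≡ coeffs · (s ⊖ s₀) * quotient l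
    coordinate {s} s∈S l = ℤP.*-cancelʳ-≡ _ _ (+ g) (begin
      vₗ * + g                          ≡⟨ cong (vₗ *_) (sym bézout) ⟩
      vₗ * coeffs · w                   ≡⟨ sym (·-⊙-comm vₗ coeffs w) ⟩
      coeffs · (vₗ ⊙ w)                 ≡⟨ cong (coeffs ·_) (parallel s∈S l) ⟩
      coeffs · (lookup w l ⊙ v)         ≡⟨ ·-⊙-comm (lookup w l) coeffs v ⟩
      lookup w l * coeffs · v           ≡⟨ cong (_* coeffs · v) (divides l) ⟩
      quotient l * + g * coeffs · v     ≡⟨ ring (quotient l) (+ g) (coeffs · v) ⟩
      coeffs · v * quotient l * + g     ∎)
      where
      open ≡-Reasoning
      v : Point d
      v = s ⊖ s₀
      vₗ : ℤ
      vₗ = lookup v l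
      ring : ∀ q g k → q * g * k ≡ k * q * g
      ring = solve-∀

  direction : Point d
  direction = V.tabulate quotient

  direction≢𝟎 : direction ≢ 𝟎
  direction≢𝟎 eq = w≢𝟎 λ l → begin
    lookup w l                  ≡⟨ divides l ⟩
    quotient l * + g            ≡⟨ cong (_* + g) (sym (VP.lookup∘tabulate quotient l)) ⟩
    lookup direction l * + g    ≡⟨ cong (λ b → lookup b l * + g) eq ⟩
    lookup (𝟎 {d}) l * + g      ≡⟨ cong (_* + g) (VP.lookup-replicate l 0ℤ) ⟩
    0ℤ                          ∎
    where open ≡-Reasoning

  on-line : ∀ {s} → s ∈ S → ∃[ k ] s ≡ s₀ ⊕ (k ⊙ direction)
  on-line {s} s∈S = k , lookup-ext λ l → begin
    lookup s l                                      ≡⟨ ring (lookup s l) (lookup s₀ l) ⟩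
    lookup s₀ l + (lookup s l - lookup s₀ l)        ≡⟨ cong (_+_ (lookup s₀ l)) (sym (lookup-⊖ s s₀ l)) ⟩
    lookup s₀ l + lookup (s ⊖ s₀) l                ≡⟨ cong (_+_ (lookup s₀ l)) (coordinate s∈S l) ⟩
    lookup s₀ l + k * quotient l
      ≡⟨ cong (λ q → lookup s₀ l + k * q) (sym (VP.lookup∘tabulate quotient l)) ⟩
    lookup s₀ l + k * lookup direction l
      ≡⟨ cong (_+_ (lookup s₀ l)) (sym (VP.lookup-map l (k *_) direction)) ⟩
    lookup s₀ l + lookup (k ⊙ direction) l          ≡⟨ sym (VP.lookup-zipWith _+_ l s₀ (k ⊙ direction)) ⟩
    lookup (s₀ ⊕ (k ⊙ direction)) l                 ∎
    where
    open ≡-Reasoning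
    k : ℤ
    k = coeffs · (s ⊖ s₀)
    ring : ∀ x y → x ≡ y + (x - y)
    ring = solve-∀

allMinorsVanish⇒Linear : ∀ {d} {S : List (Point (suc d))} {s₀} → AllMinorsVanish S s₀ → Linear S
allMinorsVanish⇒Linear {S = S} {s₀} vanish with find-or-all S (λ s → Sum.swap (toSum (s ≟ₚ s₀)))
... | inj₁ (s₁ , s₁∈S , s₁≢s₀) =
  s₀ , direction s₁∈S s₁≢s₀ vanish , direction≢𝟎 s₁∈S s₁≢s₀ vanish ,
  λ s s∈S → on-line s₁∈S s₁≢s₀ vanish s∈S
... | inj₂ all≡s₀ = s₀ , e zero , e₀≢𝟎 , λ s s∈S → 0ℤ , trans (all≡s₀ s∈S) (x≡x⊕0⊙b s₀ (e zero))

¬Linear⇒straddle : ∀ {d} {S : List (Point (suc d))} → ¬ Linear S → ∀ s₀ → Straddle S s₀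
¬Linear⇒straddle {S = S} ¬linear s₀ with nonvanishingMinor-or-allMinorsVanish S s₀
... | inj₁ (s₁ , s₁∈S , s₂ , s₂∈S , i , k , m≢0) = minor≢0⇒straddle i k s₁∈S s₂∈S m≢0
... | inj₂ vanish = ⊥-elim (¬linear (allMinorsVanish⇒Linear {s₀ = s₀} vanish))

¬Linear⇒inCone : ∀ {d} {S : List (Point (suc d))} → ¬ Linear S → ∀ c → InCone S c
¬Linear⇒inCone {S = []} ¬linear c = ⊥-elim (¬linear (𝟎 , e zero , e₀≢𝟎 , λ _ ()))
¬Linear⇒inCone {d} {S = t ∷ ts} ¬linear c =
  cone-of-tilts (tilt {u = u} s₀∈S s₀-max s⁺∈S above) (tilt {u = neg u} s₀∈S s₀-max s⁻∈S below⁻)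
  where
  s₀ : Point (suc d)
  s₀ = ℤExtrema.argmax (c ·_) t ts
  s₀∈S : s₀ ∈ t ∷ ts
  s₀∈S = ℤExtrema.argmax-all (c ·_) (here refl) (All.tabulate there)
  s₀-max : ∀ {s} → s ∈ t ∷ ts → c · s ≤ c · s₀
  s₀-max (here refl) = ℤExtrema.f[⊥]≤f[argmax] {f = c ·_} t ts
  s₀-max (there s∈ts) = All.lookup (ℤExtrema.f[xs]≤f[argmax] {f = c ·_} t ts) s∈ts
  open Straddle (¬Linear⇒straddle ¬linear s₀)
  below⁻ : neg u · s₀ < neg u · s⁻
  below⁻ = subst₂ _<_ (sym (neg-· u s₀)) (sym (neg-· u s⁻)) (ℤP.neg-mono-< below)

proposition2 : (d : ℕ) → 1 ℕ.≤ d → (S : List (Point d)) → Unique S → ¬ Linear S →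
    ((P : List (Point d)) → FiniteClosure S P)
    × ((P : List (Point d)) → FiniteOrbit S P)
-- The argument never uses that S is duplicate-free.
proposition2 (suc d) _ S _ ¬linear = finiteClosure cones , finiteOrbit cones
  where
  cones : ∀ j → InCone S (e j) × InCone S (neg (e j))
  cones j = ¬Linear⇒inCone ¬linear (e j) , ¬Linear⇒inCone ¬linear (neg (e j))
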